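{- Let $\mathbb F$ be a finite field of odd order and $Q=Q_{a,b}$ a quadratic quasigroup upon $\mathbb F$. If $\operatorname{char}(\mathbb F)=3$, then every minimal subquasigroup of $Q$ is a coset of a subspace of $\mathbb F$. If $\operatorname{char}(\mathbb F)\ne3$, then either every minimal subquasigroup of $Q$ is a coset of a subspace of $\mathbb F$, or $ab=a+b=a-a^2=b-b^2=-a^3=-b^3=1$ and $\chi(a)=\chi(b)=\chi(1-a)=\chi(1-b)=\chi(-1)=-1$.
   Context: $\chi$ is the quadratic character of $\mathbb F$ ($\chi(0)=0$, $1$ on nonzero squares, $-1$ on nonsquares). For $a,b\in\mathbb F$ with $\chi(a)=\chi(b)\ne0$ and $\chi(1-a)=\chi(1-b)\ne0$, $Q_{a,b}$ is $(\mathbb F,*)$ with $x*y=x+a(y-x)$ if $\chi(y-x)\ge0$ and $x*y=x+b(y-x)$ if $\chi(y-x)=-1$. A subspace of $\mathbb F$ means a subspace of $\mathbb F$ as a vector space over its prime field. A subquasigroup is trivial if it has at most one element; a minimal subquasigroup is a nontrivial subquasigroup all of whose proper subquasigroups are trivial. -}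

module Defs where

open import Level using (0ℓ)
open import Data.Nat as ℕ using (ℕ; zero; suc)
open import Data.Fin using (Fin)
open import Data.Fin.Properties using (any?)
open import Data.Integer as ℤ using (ℤ; +_; -[1+_])
open import Data.Bool using (Bool; true; false; if_then_else_)
open import Data.Product using (∃; _×_; _,_; proj₁; proj₂)
open import Relation.Nullary using (¬_; Dec; yes; no; does)
open import Relation.Binary.PropositionalEquality using (_≡_; _≢_; refl; sym; trans; cong)
open import Relation.Binary.Definitions using (DecidableEquality)
open import Algebra.Core using (Op₁; Op₂)
open import Algebra.Structures using (IsCommutativeRing)

record FiniteField : Set₁ where
  infixl 6 _+_ _-_
  infixl 7 _*_
  field
    Carrier : Set
    _+_ _*_ : Op₂ Carrier
    -_      : Op₁ Carrier
    0# 1#   : Carrier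
    isCommutativeRing : IsCommutativeRing _≡_ _+_ _*_ -_ 0# 1#
    0≢1     : 0# ≢ 1#
    inverse : ∀ x → x ≢ 0# → ∃ λ y → x * y ≡ 1#
    _≟_     : DecidableEquality Carrier
    size    : ℕ
    enum    : Fin size → Carrier
    enum-injective  : ∀ i j → enum i ≡ enum j → i ≡ j
    enum-surjective : ∀ x → ∃ λ i → enum i ≡ x

  _-_ : Op₂ Carrier
  x - y = x + (- y)

  _×1 : ℕ → Carrier
  zero ×1  = 0#
  suc n ×1 = 1# + n ×1

  HasCharacteristic : ℕ → Set
  HasCharacteristic p =
    (0 ℕ.< p) × (p ×1 ≡ 0#) × (∀ m → 0 ℕ.< m → m ℕ.< p → m ×1 ≢ 0#)

  IsSquare : Carrier → Set
  IsSquare x = ∃ λ y → y * y ≡ x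

  square? : ∀ x → Dec (IsSquare x)
  square? x with any? {n = size} (λ i → (enum i * enum i) ≟ x)
  ... | yes (i , e) = yes (enum i , e)
  ... | no ¬p = no λ { (y , e) → ¬p (proj₁ (enum-surjective y)
        , trans (cong (λ z → z * z) (proj₂ (enum-surjective y))) e) }

  χ : Carrier → ℤ
  χ x with x ≟ 0#
  ... | yes _ = + 0
  ... | no _ with square? x
  ...   | yes _ = + 1
  ...   | no _  = -[1+ 0 ]

  qop : Carrier → Carrier → Carrier → Carrier → Carrier
  qop a b x y =
    if does (+ 0 ℤ.≤? χ (y - x)) then x + a * (y - x) else x + b * (y - x)

  QuadraticParameters : Carrier → Carrier → Set
  QuadraticParameters a b =
    (χ a ≡ χ b) × (χ a ≢ + 0) × (χ (1# - a) ≡ χ (1# - b)) × (χ (1# - a) ≢ + 0)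

  Subset : Set
  Subset = Carrier → Bool

  _∈_ : Carrier → Subset → Set
  x ∈ S = S x ≡ true

  _⊆_ : Subset → Subset → Set
  T ⊆ S = ∀ x → x ∈ T → x ∈ S

  _⊂_ : Subset → Subset → Set
  T ⊂ S = (T ⊆ S) × ∃ λ x → (x ∈ S) × ¬ (x ∈ T)

  IsSubquasigroup : Carrier → Carrier → Subset → Set
  IsSubquasigroup a b S = ∀ x y → x ∈ S → y ∈ S → qop a b x y ∈ S

  Trivial : Subset → Set
  Trivial S = ∀ x y → x ∈ S → y ∈ S → x ≡ y

  IsMinimalSubquasigroup : Carrier → Carrier → Subset → Set
  IsMinimalSubquasigroup a b S =
    IsSubquasigroup a b S × ¬ Trivial S ×
    (∀ T → IsSubquasigroup a b T → T ⊂ S → Trivial T)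

  -- subspace of F as a vector space over its prime field { n ×1 }
  IsSubspace : Subset → Set
  IsSubspace V =
    (0# ∈ V) × (∀ u v → u ∈ V → v ∈ V → (u + v) ∈ V) ×
    (∀ n v → v ∈ V → (n ×1 * v) ∈ V)

  IsCosetOfSubspace : Subset → Set
  IsCosetOfSubspace S =
    ∃ λ V → IsSubspace V × ∃ λ c → ∀ x → S x ≡ V (x - c)

  EveryMinimalIsCoset : Carrier → Carrier → Set
  EveryMinimalIsCoset a b =
    ∀ S → IsMinimalSubquasigroup a b S → IsCosetOfSubspace S

  Exceptional : Carrier → Carrier → Set
  Exceptional a b =
    (a * b ≡ 1#) × (a + b ≡ 1#) × (a - a * a ≡ 1#) × (b - b * b ≡ 1#) ×
    (- (a * a * a) ≡ 1#) × (- (b * b * b) ≡ 1#) ×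
    (χ a ≡ -[1+ 0 ]) × (χ b ≡ -[1+ 0 ]) × (χ (1# - a) ≡ -[1+ 0 ]) ×
    (χ (1# - b) ≡ -[1+ 0 ]) × (χ (- 1#) ≡ -[1+ 0 ])

{-# OPTIONS --safe #-}
-- A homothety h z = x + α (z - x) with χ α = 1 preserves χ of differences, hence is an
-- automorphism of Q_{a,b}.  If it maps a point y ≠ x of a minimal subquasigroup S (with x ∈ S)
-- into S, then S ∩ h⁻¹ S is a nontrivial subquasigroup, so S is invariant under h.  The products
-- x*y, x*(x*y), y*x and (x*y)*x are images of y under homotheties centred at x of ratios
-- c, ab, 1 - c and c - c² (c ∈ {a, b}); unless a = b, or ab = a + b = 1 with χ a = χ (1 - a) = -1,
-- one of them is a square other than 0 and 1.  Then every point of S is the centre of a homothety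
-- of ratio ≠ 0, 1 preserving S, the commutators of two such homotheties are translations, and S
-- is closed under the translations by its own differences: a coset of a subspace.  In
-- characteristic 3, ab = a + b = 1 forces (a - b)² = 1 - 4 = 0, i.e. a = b.
--
-- That χ is multiplicative is a counting argument: squaring is two-to-one on the nonzero
-- elements, so there are at most as many nonsquares as nonzero squares, whereas a product n m of
-- nonsquares that is a nonsquare would let x ↦ n x inject the nonzero squares and m into the
-- nonsquares.
module Submission where

open import Defs
open import Level using (0ℓ)
open import Algebra.Bundles using (CommutativeRing; RawRing)
open import Data.Bool as Bool using (true; false; if_then_else_; _∧_)
open import Data.Empty using (⊥-elim)
open import Data.Integer as ℤ using (ℤ; -[1+_]; 0ℤ; 1ℤ; -1ℤ)
import Data.Integer.Properties as ℤ
open import Data.Nat as ℕ using (ℕ; zero; suc; _%_)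
import Data.Nat.Properties as ℕ
open import Data.Product using (_×_; _,_; proj₁; proj₂; ∃; ∃₂)
open import Data.Sum as Sum using (_⊎_; inj₁; inj₂; [_,_])
open import Function using (_∘_; id)
open import Relation.Nullary using (¬_; ¬?; Dec; yes; no; does)
open import Relation.Nullary.Decidable using (_×-dec_)
open import Relation.Unary using (Pred; Decidable; ∁; _∪_; _∩_; _≐_)
open import Relation.Unary.Properties using (∁?; _∩?_; _∪?_)
open import Relation.Binary.PropositionalEquality
  using (_≡_; _≢_; refl; sym; trans; cong; cong₂; subst; module ≡-Reasoning)

-- The ring solver needs decidable equality of coefficients, which an abstract ring lacks;
-- integer coefficients, interpreted by ι : ℤ → R, provide it.
module IntegerCoefficients {c ℓ} (R : CommutativeRing c ℓ) where
  open CommutativeRing R renaming (refl to ≈-refl; sym to ≈-sym; trans to ≈-trans)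
  import Data.Sign as Sign
  open import Data.Maybe using (Maybe; just; nothing)
  open import Algebra.Properties.Ring ring
    using (-0#≈0#; -‿involutive; -‿+-comm; -‿distribˡ-*; -‿distribʳ-*)
  -- With the optimised multiple, ι (+ 1) is definitionally 1#, so that :1 below denotes 1#.
  open import Algebra.Properties.Semiring.Mult.TCOptimised semiring using (1+×; ×-homo-+; ×1-homo-*)
    renaming (_×_ to _×′_)
  open import Algebra.Properties.CommutativeSemigroup +-commutativeSemigroup using (interchange)
  open import Algebra.Solver.Ring.AlmostCommutativeRing
    using (_-Raw-AlmostCommutative⟶_; fromCommutativeRing)
  open import Relation.Binary.Reasoning.Setoid setoid

  ι : ℤ → Carrier
  ι (ℤ.+ n)  = n ×′ 1#
  ι -[1+ n ] = - (suc n ×′ 1#)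

  ι-⊖ : ∀ m n → ι (m ℤ.⊖ n) ≈ m ×′ 1# - n ×′ 1#
  ι-⊖ zero    zero    = ≈-sym (-‿inverseʳ 0#)
  ι-⊖ (suc m) zero    = ≈-sym (≈-trans (+-congˡ -0#≈0#) (+-identityʳ _))
  ι-⊖ zero    (suc n) = ≈-sym (+-identityˡ _)
  ι-⊖ (suc m) (suc n) = begin
    ι (suc m ℤ.⊖ suc n)                   ≡⟨ cong ι (ℤ.[1+m]⊖[1+n]≡m⊖n m n) ⟩
    ι (m ℤ.⊖ n)                           ≈⟨ ι-⊖ m n ⟩
    m ×′ 1# - n ×′ 1#                       ≈⟨ +-identityˡ _ ⟨
    0# + (m ×′ 1# - n ×′ 1#)                ≈⟨ +-congʳ (-‿inverseʳ 1#) ⟨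
    (1# - 1#) + (m ×′ 1# - n ×′ 1#)         ≈⟨ interchange 1# (- 1#) (m ×′ 1#) (- (n ×′ 1#)) ⟩
    (1# + m ×′ 1#) + (- 1# - n ×′ 1#)       ≈⟨ +-congˡ (-‿+-comm 1# (n ×′ 1#)) ⟩
    (1# + m ×′ 1#) - (1# + n ×′ 1#)         ≈⟨ +-cong (1+× m 1#) (-‿cong (1+× n 1#)) ⟨
    suc m ×′ 1# - suc n ×′ 1#               ∎

  ι-+ : ∀ i j → ι (i ℤ.+ j) ≈ ι i + ι j
  ι-+ (ℤ.+ m)  (ℤ.+ n)  = ×-homo-+ 1# m n
  ι-+ (ℤ.+ m)  -[1+ n ] = ι-⊖ m (suc n)
  ι-+ -[1+ m ] (ℤ.+ n)  = ≈-trans (ι-⊖ n (suc m)) (+-comm _ _)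
  ι-+ -[1+ m ] -[1+ n ] = begin
    - (suc (suc (m ℕ.+ n)) ×′ 1#)          ≡⟨ cong (λ k → - (suc k ×′ 1#)) (ℕ.+-suc m n) ⟨
    - ((suc m ℕ.+ suc n) ×′ 1#)            ≈⟨ -‿cong (×-homo-+ 1# (suc m) (suc n)) ⟩
    - (suc m ×′ 1# + suc n ×′ 1#)           ≈⟨ -‿+-comm _ _ ⟨
    - (suc m ×′ 1#) - suc n ×′ 1#           ∎

  ι-neg : ∀ i → ι (ℤ.- i) ≈ - ι i
  ι-neg (ℤ.+ zero)  = ≈-sym -0#≈0#
  ι-neg (ℤ.+ suc n) = ≈-refl
  ι-neg -[1+ n ]    = ≈-sym (-‿involutive _)

  signed : Sign.Sign → Carrier → Carrier
  signed Sign.+ x = x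
  signed Sign.- x = - x

  ι-◃ : ∀ s n → ι (s ℤ.◃ n) ≈ signed s (n ×′ 1#)
  ι-◃ Sign.+ zero    = ≈-refl
  ι-◃ Sign.- zero    = ≈-sym -0#≈0#
  ι-◃ Sign.+ (suc n) = ≈-refl
  ι-◃ Sign.- (suc n) = ≈-refl

  ι-signed : ∀ i → ι i ≈ signed (ℤ.sign i) (ℤ.∣ i ∣ ×′ 1#)
  ι-signed (ℤ.+ n)  = ≈-refl
  ι-signed -[1+ n ] = ≈-refl

  signed-* : ∀ s t x y → signed (s Sign.* t) (x * y) ≈ signed s x * signed t y
  signed-* Sign.+ Sign.+ x y = ≈-refl
  signed-* Sign.+ Sign.- x y = -‿distribʳ-* x y
  signed-* Sign.- Sign.+ x y = -‿distribˡ-* x y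
  signed-* Sign.- Sign.- x y = begin
    x * y         ≈⟨ -‿involutive _ ⟨
    - - (x * y)   ≈⟨ -‿cong (-‿distribˡ-* x y) ⟩
    - (- x * y)   ≈⟨ -‿distribʳ-* (- x) y ⟩
    - x * - y     ∎

  ι-* : ∀ i j → ι (i ℤ.* j) ≈ ι i * ι j
  ι-* i j = begin
    ι (s ℤ.◃ (ℤ.∣ i ∣ ℕ.* ℤ.∣ j ∣))              ≈⟨ ι-◃ s (ℤ.∣ i ∣ ℕ.* ℤ.∣ j ∣) ⟩
    signed s ((ℤ.∣ i ∣ ℕ.* ℤ.∣ j ∣) ×′ 1#)        ≈⟨ signed-cong s (×1-homo-* ℤ.∣ i ∣ ℤ.∣ j ∣) ⟩
    signed s (ℤ.∣ i ∣ ×′ 1# * ℤ.∣ j ∣ ×′ 1#)       ≈⟨ signed-* (ℤ.sign i) (ℤ.sign j) _ _ ⟩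
    signed (ℤ.sign i) (ℤ.∣ i ∣ ×′ 1#) * signed (ℤ.sign j) (ℤ.∣ j ∣ ×′ 1#)
                                                  ≈⟨ *-cong (ι-signed i) (ι-signed j) ⟨
    ι i * ι j                                     ∎
    where
    s = ℤ.sign i Sign.* ℤ.sign j
    signed-cong : ∀ s {x y} → x ≈ y → signed s x ≈ signed s y
    signed-cong Sign.+ e = e
    signed-cong Sign.- e = -‿cong e

  ℤ-rawRing : RawRing 0ℓ 0ℓ
  ℤ-rawRing = CommutativeRing.rawRing ℤ.+-*-commutativeRing

  ι-homomorphism : ℤ-rawRing -Raw-AlmostCommutative⟶ fromCommutativeRing R
  ι-homomorphism = record
    { ⟦_⟧ = ι ; +-homo = ι-+ ; *-homo = ι-* ; -‿homo = ι-neg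
    ; 0-homo = ≈-refl ; 1-homo = ≈-refl }

  ι-≟ : ∀ i j → Maybe (ι i ≈ ι j)
  ι-≟ i j with i ℤ.≟ j
  ... | yes refl = just ≈-refl
  ... | no _     = nothing

  open import Algebra.Solver.Ring ℤ-rawRing (fromCommutativeRing R) ι-homomorphism ι-≟ public
    using (solve; _:=_; _:+_; _:*_; _:-_; :-_; con; Polynomial)

  :1 : ∀ {n} → Polynomial n
  :1 = con (ℤ.+ 1)

module Counting {A : Set} where
  open import Data.Nat using (_+_; _≤_; _<_; z≤n; s≤s)
  open import Data.List using (List; []; _∷_; _++_; [_]; length; filter; map)
  open import Data.List.Properties using (length-++; length-map; filter-≐; filter-some)
  open import Data.List.Membership.Propositional using (_∈_; lose)
  open import Data.List.Membership.Propositional.Properties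
    using (∈-∃++; ∈-++⁻; ∈-++⁺ˡ; ∈-++⁺ʳ; ∈-map⁻; ∈-filter⁺; ∈-filter⁻)
  open import Data.List.Relation.Unary.Any using (here; there)
  open import Data.List.Relation.Unary.All as All using (All; []; _∷_)
  open import Data.List.Relation.Unary.Unique.Propositional using (Unique; []; _∷_)
  import Data.List.Relation.Unary.Unique.Propositional.Properties as Unique

  private
    variable
      P Q : Pred A 0ℓ

  length-filter-split : (P? : Decidable P) (Q? : Decidable Q) (xs : List A) →
    length (filter P? xs) ≡ length (filter (P? ∩? Q?) xs) + length (filter (P? ∩? ∁? Q?) xs)
  length-filter-split P? Q? [] = refl
  length-filter-split P? Q? (x ∷ xs) with P? x | Q? x
  ... | yes _ | yes _ = cong suc (length-filter-split P? Q? xs)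
  ... | yes _ | no _  = trans (cong suc (length-filter-split P? Q? xs)) (sym (ℕ.+-suc _ _))
  ... | no _  | _     = length-filter-split P? Q? xs

  length-filter-∁ : (P? : Decidable P) (xs : List A) →
    length (filter P? xs) + length (filter (∁? P?) xs) ≡ length xs
  length-filter-∁ P? [] = refl
  length-filter-∁ P? (x ∷ xs) with P? x
  ... | yes _ = cong suc (length-filter-∁ P? xs)
  ... | no _  = trans (ℕ.+-suc _ _) (cong suc (length-filter-∁ P? xs))

  unique-⊆⇒length-≤ : ∀ {xs ys : List A} → Unique xs → (∀ {x} → x ∈ xs → x ∈ ys) → length xs ≤ length ys
  unique-⊆⇒length-≤ {[]}     _          _   = z≤n
  unique-⊆⇒length-≤ {x ∷ xs} (x∉xs ∷ u) sub with ∈-∃++ (sub (here refl))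
  ... | ys , zs , refl = begin
    suc (length xs)             ≤⟨ s≤s (unique-⊆⇒length-≤ u (λ m → remove (sub (there m)) (All.lookup x∉xs m))) ⟩
    suc (length (ys ++ zs))     ≡⟨ cong suc (length-++ ys) ⟩
    suc (length ys + length zs) ≡⟨ ℕ.+-suc _ _ ⟨
    length ys + length (x ∷ zs) ≡⟨ length-++ ys ⟨
    length (ys ++ x ∷ zs)       ∎
    where
    open ℕ.≤-Reasoning
    remove : ∀ {y} → y ∈ ys ++ [ x ] ++ zs → x ≢ y → y ∈ ys ++ zs
    remove m x≢y with ∈-++⁻ ys m
    ... | inj₁ m′          = ∈-++⁺ˡ m′
    ... | inj₂ (here y≡x)  = ⊥-elim (x≢y (sym y≡x))
    ... | inj₂ (there m′)  = ∈-++⁺ʳ ys m′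

  map⁺-injectiveOn : ∀ {P : Pred A 0ℓ} {f : A → A} {xs} → All P xs → (∀ {x y} → P x → P y → f x ≡ f y → x ≡ y) →
                     Unique xs → Unique (map f xs)
  map⁺-injectiveOn [] inj [] = []
  map⁺-injectiveOn {P = P} {f = f} (px ∷ pxs) inj (x∉xs ∷ u) =
    distinct px pxs x∉xs ∷ map⁺-injectiveOn pxs inj u
    where
    distinct : ∀ {x zs} → P x → All P zs → All (x ≢_) zs → All (f x ≢_) (map f zs)
    distinct px [] [] = []
    distinct px (pz ∷ pzs) (x≢z ∷ x≢zs) = (λ e → x≢z (inj px pz e)) ∷ distinct px pzs x≢zs

  module OverUniverse (universe : List A) (universe-unique : Unique universe)
                      (∈-universe : ∀ x → x ∈ universe) where

    count : Decidable P → ℕ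
    count P? = length (filter P? universe)

    count-split : (P? : Decidable P) (Q? : Decidable Q) →
                  count P? ≡ count (P? ∩? Q?) + count (P? ∩? ∁? Q?)
    count-split P? Q? = length-filter-split P? Q? universe

    count-≐ : (P? : Decidable P) (Q? : Decidable Q) → P ≐ Q → count P? ≡ count Q?
    count-≐ P? Q? P≐Q = cong length (filter-≐ P? Q? P≐Q universe)

    count-pos : (P? : Decidable P) → ∀ {x} → P x → 0 < count P?
    count-pos P? px = filter-some P? (lose (∈-universe _) px)

    count-≤-injectiveOn : (P? : Decidable P) (Q? : Decidable Q) (f : A → A) →
      (∀ {x} → P x → Q (f x)) → (∀ {x y} → P x → P y → f x ≡ f y → x ≡ y) →
      count P? ≤ count Q?
    count-≤-injectiveOn P? Q? f f[P]⊆Q inj = begin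
      count P?                             ≡⟨ length-map f (filter P? universe) ⟨
      length (map f (filter P? universe))  ≤⟨ unique-⊆⇒length-≤ image-unique image-⊆ ⟩
      count Q?                             ∎
      where
      open ℕ.≤-Reasoning
      image-unique : Unique (map f (filter P? universe))
      image-unique = map⁺-injectiveOn (All.tabulate (λ m → proj₂ (∈-filter⁻ P? {xs = universe} m))) inj
                                      (Unique.filter⁺ P? universe-unique)
      image-⊆ : ∀ {y} → y ∈ map f (filter P? universe) → y ∈ filter Q? universe
      image-⊆ m with ∈-map⁻ f m
      ... | x , x∈ , refl = ∈-filter⁺ Q? (∈-universe (f x)) (f[P]⊆Q (proj₂ (∈-filter⁻ P? {xs = universe} x∈)))

    fixedPointFree-involution⇒even : (rank : A → ℕ) → (∀ {x y} → rank x ≡ rank y → x ≡ y) →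
      (g : A → A) → (∀ x → g (g x) ≡ x) → (∀ x → g x ≢ x) → ∃ λ k → length universe ≡ k ℕ.* 2
    fixedPointFree-involution⇒even rank rank-injective g gg≡id g≢id =
      count Lower? , (begin
        length universe                   ≡⟨ length-filter-∁ Lower? universe ⟨
        count Lower? + count (∁? Lower?)  ≡⟨ cong (count Lower? +_) (ℕ.≤-antisym (swap ∁Lower⇒Lower) (swap Lower⇒∁Lower)) ⟩
        count Lower? + count Lower?       ≡⟨ cong (count Lower? +_) (ℕ.+-identityʳ (count Lower?)) ⟨
        2 ℕ.* count Lower?                ≡⟨ ℕ.*-comm 2 (count Lower?) ⟩
        count Lower? ℕ.* 2                ∎)
      where
      open ≡-Reasoning
      Lower : Pred A 0ℓ
      Lower x = rank x < rank (g x)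
      Lower? : Decidable Lower
      Lower? x = rank x ℕ.<? rank (g x)
      Lower⇒∁Lower : ∀ {x} → Lower x → ¬ Lower (g x)
      Lower⇒∁Lower {x} p q = ℕ.<-asym p (subst (λ z → rank (g x) < rank z) (gg≡id x) q)
      ∁Lower⇒Lower : ∀ {x} → ¬ Lower x → Lower (g x)
      ∁Lower⇒Lower {x} ¬p = subst (λ z → rank (g x) < rank z) (sym (gg≡id x))
        (ℕ.≤∧≢⇒< (ℕ.≮⇒≥ ¬p) (λ e → g≢id x (rank-injective e)))
      g-injective : ∀ {x y} → g x ≡ g y → x ≡ y
      g-injective {x} {y} e = trans (sym (gg≡id x)) (trans (cong g e) (gg≡id y))
      swap : ∀ {R S : Pred A 0ℓ} {R? : Decidable R} {S? : Decidable S} →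
             (∀ {x} → R x → S (g x)) → count R? ≤ count S?
      swap {R? = R?} {S?} R⇒Sg = count-≤-injectiveOn R? S? g R⇒Sg (λ _ _ → g-injective)

module FiniteFieldProperties (F : FiniteField) where
  open FiniteField F
  open import Data.Fin using (Fin; toℕ)
  import Data.Fin.Properties as Fin
  open import Data.List using (List; tabulate; length)
  open import Data.List.Properties using (length-tabulate)
  open import Data.List.Membership.Propositional using () renaming (_∈_ to _∈ˡ_)
  open import Data.List.Membership.Propositional.Properties using (∈-tabulate⁺)
  open import Data.List.Relation.Unary.Unique.Propositional using (Unique)
  import Data.List.Relation.Unary.Unique.Propositional.Properties as Unique
  open import Data.Nat using (_<_)
  open import Data.Nat.DivMod using (m*n%n≡0)

  commutativeRing : CommutativeRing 0ℓ 0ℓ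
  commutativeRing = record { isCommutativeRing = isCommutativeRing }

  open CommutativeRing commutativeRing public
    using (+-assoc; +-comm; +-identityˡ; +-identityʳ; -‿inverseʳ; *-assoc; *-comm; *-identityˡ; *-identityʳ; zeroˡ; zeroʳ)
  open import Algebra.Properties.Ring (CommutativeRing.ring commutativeRing) public
    using (x∙y⁻¹≈ε⇒x≈y; +-inverseʳ-unique; -‿involutive; -0#≈0#)
  open import Algebra.Properties.Semiring.Exp (CommutativeRing.semiring commutativeRing) public
    using (_^_; ^-homo-*)
  open IntegerCoefficients commutativeRing public
    using (solve; _:=_; _:+_; _:*_; _:-_; :-_; con; :1)

  1≢0 : 1# ≢ 0#
  1≢0 e = 0≢1 (sym e)

  x-y≡0⇒x≡y : ∀ {x y} → x - y ≡ 0# → x ≡ y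
  x-y≡0⇒x≡y = x∙y⁻¹≈ε⇒x≈y _ _

  x*y≡0⇒y≡0 : ∀ {x y} → x ≢ 0# → x * y ≡ 0# → y ≡ 0#
  x*y≡0⇒y≡0 {x} {y} x≢0 xy≡0 = begin
    y                 ≡⟨ *-identityˡ y ⟨
    1# * y            ≡⟨ cong (_* y) xx⁻¹≡1 ⟨
    (x * x⁻¹) * y     ≡⟨ solve 3 (λ x x⁻¹ y → (x :* x⁻¹) :* y := x⁻¹ :* (x :* y)) refl x x⁻¹ y ⟩
    x⁻¹ * (x * y)     ≡⟨ cong (x⁻¹ *_) xy≡0 ⟩
    x⁻¹ * 0#          ≡⟨ zeroʳ x⁻¹ ⟩
    0#                ∎
    where
    open ≡-Reasoning
    x⁻¹ = proj₁ (inverse x x≢0)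
    xx⁻¹≡1 = proj₂ (inverse x x≢0)

  *-≢0 : ∀ {x y} → x ≢ 0# → y ≢ 0# → x * y ≢ 0#
  *-≢0 x≢0 y≢0 xy≡0 = y≢0 (x*y≡0⇒y≡0 x≢0 xy≡0)

  *-cancelˡ : ∀ {c x y} → c ≢ 0# → c * x ≡ c * y → x ≡ y
  *-cancelˡ {c} {x} {y} c≢0 cx≡cy = x-y≡0⇒x≡y (x*y≡0⇒y≡0 c≢0 (begin
    c * (x - y)       ≡⟨ solve 3 (λ c x y → c :* (x :- y) := c :* x :- c :* y) refl c x y ⟩
    c * x - c * y     ≡⟨ cong (_- c * y) cx≡cy ⟩
    c * y - c * y     ≡⟨ -‿inverseʳ (c * y) ⟩
    0#                ∎))
    where open ≡-Reasoning

  +-cancelˡ : ∀ {c x y} → c + x ≡ c + y → x ≡ y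
  +-cancelˡ {c} {x} {y} e = begin
    x                 ≡⟨ solve 2 (λ c x → x := (c :+ x) :- c) refl c x ⟩
    (c + x) - c       ≡⟨ cong (_- c) e ⟩
    (c + y) - c       ≡⟨ solve 2 (λ c y → (c :+ y) :- c := y) refl c y ⟩
    y                 ∎
    where open ≡-Reasoning

  1-x≢0 : ∀ {x} → x ≢ 1# → 1# - x ≢ 0#
  1-x≢0 x≢1 1-x≡0 = x≢1 (sym (x-y≡0⇒x≡y 1-x≡0))

  1-x≢1 : ∀ {x} → x ≢ 0# → 1# - x ≢ 1#
  1-x≢1 {x} x≢0 1-x≡1 = x≢0 (begin
    x                  ≡⟨ solve 1 (λ x → x := :1 :- (:1 :- x)) refl x ⟩
    1# - (1# - x)      ≡⟨ cong (λ u → 1# - u) 1-x≡1 ⟩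
    1# - 1#            ≡⟨ -‿inverseʳ 1# ⟩
    0#                 ∎)
    where open ≡-Reasoning

  ×1-homo-+ : ∀ m n → (m ℕ.+ n) ×1 ≡ m ×1 + n ×1
  ×1-homo-+ zero    n = sym (+-identityˡ (n ×1))
  ×1-homo-+ (suc m) n = trans (cong (1# +_) (×1-homo-+ m n)) (sym (+-assoc 1# (m ×1) (n ×1)))

  x*x≡0⇒x≡0 : ∀ {x} → x * x ≡ 0# → x ≡ 0#
  x*x≡0⇒x≡0 {x} x²≡0 with x ≟ 0#
  ... | yes x≡0 = x≡0
  ... | no  x≢0 = x*y≡0⇒y≡0 x≢0 x²≡0

  x*y≡1∧x-x*x≡1⇒x+y≡1 : ∀ {x y} → x * y ≡ 1# → x - x * x ≡ 1# → x + y ≡ 1#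
  x*y≡1∧x-x*x≡1⇒x+y≡1 {x} {y} xy≡1 x-xx≡1 = begin
    x + y                      ≡⟨ solve 2 (λ x y → x :+ y := x :+ y :* :1) refl x y ⟩
    x + y * 1#                 ≡⟨ cong (λ u → x + y * u) x-xx≡1 ⟨
    x + y * (x - x * x)        ≡⟨ solve 2 (λ x y → x :+ y :* (x :- x :* x) := x :+ x :* y :- (x :* y) :* x) refl x y ⟩
    x + x * y - (x * y) * x    ≡⟨ cong (λ u → x + u - u * x) xy≡1 ⟩
    x + 1# - 1# * x            ≡⟨ solve 1 (λ x → x :+ :1 :- :1 :* x := :1) refl x ⟩
    1#                         ∎
    where open ≡-Reasoning

  x+y≡1∧x*y≡1⇒x-x*x≡1 : ∀ {x y} → x + y ≡ 1# → x * y ≡ 1# → x - x * x ≡ 1#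
  x+y≡1∧x*y≡1⇒x-x*x≡1 {x} {y} x+y≡1 xy≡1 = begin
    x - x * x                  ≡⟨ solve 2 (λ x y → x :- x :* x := x :* y :+ x :* (:1 :- (x :+ y))) refl x y ⟩
    x * y + x * (1# - (x + y)) ≡⟨ cong₂ (λ u v → u + x * (1# - v)) xy≡1 x+y≡1 ⟩
    1# + x * (1# - 1#)         ≡⟨ solve 1 (λ x → :1 :+ x :* (:1 :- :1) := :1) refl x ⟩
    1#                         ∎
    where open ≡-Reasoning

  x+y≡1∧x*y≡1⇒-x*x*x≡1 : ∀ {x y} → x + y ≡ 1# → x * y ≡ 1# → - (x * x * x) ≡ 1#
  x+y≡1∧x*y≡1⇒-x*x*x≡1 {x} {y} x+y≡1 xy≡1 = begin
    - (x * x * x)                                     ≡⟨ solve 2 (λ x y → :- (x :* x :* x)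
                                                           := :- ((x :* (x :+ y) :- x :* y) :* (x :+ y) :- x :* (x :* y))) refl x y ⟩
    - ((x * (x + y) - x * y) * (x + y) - x * (x * y)) ≡⟨ cong₂ (λ u v → - ((x * u - v) * u - x * v)) x+y≡1 xy≡1 ⟩
    - ((x * 1# - 1#) * 1# - x * 1#)                   ≡⟨ solve 1 (λ x → :- ((x :* :1 :- :1) :* :1 :- x :* :1) := :1) refl x ⟩
    1#                                                ∎
    where open ≡-Reasoning

  -- (x - y)² = (x + y)² - 4xy = 1 - 4 = -3.
  x+y≡1∧x*y≡1⇒x≡y : ∀ {x y} → 3 ×1 ≡ 0# → x + y ≡ 1# → x * y ≡ 1# → x ≡ y
  x+y≡1∧x*y≡1⇒x≡y {x} {y} 3≡0 x+y≡1 xy≡1 = x-y≡0⇒x≡y (x*x≡0⇒x≡0 (begin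
    (x - y) * (x - y)                                 ≡⟨ solve 2 (λ x y → (x :- y) :* (x :- y)
                                                           := (x :+ y) :* (x :+ y) :- (:1 :+ :1 :+ :1 :+ :1) :* (x :* y)) refl x y ⟩
    (x + y) * (x + y) - (1# + 1# + 1# + 1#) * (x * y) ≡⟨ cong₂ (λ u v → u * u - (1# + 1# + 1# + 1#) * v) x+y≡1 xy≡1 ⟩
    1# * 1# - (1# + 1# + 1# + 1#) * 1#                ≡⟨ solve 0 (:1 :* :1 :- (:1 :+ :1 :+ :1 :+ :1) :* :1
                                                           := :- (:1 :+ (:1 :+ (:1 :+ con (ℤ.+ 0))))) refl ⟩
    - (3 ×1)                                          ≡⟨ cong -_ 3≡0 ⟩
    - 0#                                              ≡⟨ -0#≈0# ⟩
    0#                                                ∎))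
    where open ≡-Reasoning

  index : Carrier → Fin size
  index x = proj₁ (enum-surjective x)

  index-injective : ∀ {x y} → index x ≡ index y → x ≡ y
  index-injective {x} {y} e =
    trans (sym (proj₂ (enum-surjective x))) (trans (cong enum e) (proj₂ (enum-surjective y)))

  elements : List Carrier
  elements = tabulate enum

  elements-unique : Unique elements
  elements-unique = Unique.tabulate⁺ (enum-injective _ _)

  ∈-elements : ∀ x → x ∈ˡ elements
  ∈-elements x = subst (_∈ˡ elements) (proj₂ (enum-surjective x)) (∈-tabulate⁺ (index x))

  open Counting.OverUniverse elements elements-unique ∈-elements

  nontrivial⇒inhabited : ∀ {S} → ¬ Trivial S → ∃ λ x → x ∈ S
  nontrivial⇒inhabited {S} nontrivial with Fin.any? (λ i → S (enum i) Bool.≟ true)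
  ... | yes (i , enumᵢ∈S) = enum i , enumᵢ∈S
  ... | no  S≡∅ = ⊥-elim (nontrivial λ u _ u∈S _ →
          ⊥-elim (S≡∅ (index u , trans (cong S (proj₂ (enum-surjective u))) u∈S)))

  rank : Carrier → ℕ
  rank x = toℕ (index x)

  rank-injective : ∀ {x y} → rank x ≡ rank y → x ≡ y
  rank-injective e = index-injective (Fin.toℕ-injective e)

  -- In characteristic 2, x ↦ x + 1 would pair off the elements of F.
  1+1≢0 : size % 2 ≡ 1 → 1# + 1# ≢ 0#
  1+1≢0 odd 1+1≡0 =
    let k , |elements|≡k*2 = fixedPointFree-involution⇒even rank rank-injective (_+ 1#) +1+1 +1≢id
    in ℕ.0≢1+n (begin
      0                        ≡⟨ m*n%n≡0 k 2 ⟨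
      (k ℕ.* 2) % 2            ≡⟨ cong (_% 2) |elements|≡k*2 ⟨
      length elements % 2      ≡⟨ cong (_% 2) (length-tabulate enum) ⟩
      size % 2                 ≡⟨ odd ⟩
      1                        ∎)
    where
    open ≡-Reasoning
    +1+1 : ∀ x → (x + 1#) + 1# ≡ x
    +1+1 x = trans (+-assoc x 1# 1#) (trans (cong (x +_) 1+1≡0) (+-identityʳ x))
    +1≢id : ∀ x → x + 1# ≢ x
    +1≢id x e = 1≢0 (+-cancelˡ (trans e (sym (+-identityʳ x))))

  repetition : (g : ℕ → Carrier) → ∃₂ λ i d → g i ≡ g (i ℕ.+ suc d)
  repetition g with Fin.pigeonhole (ℕ.n<1+n size) (λ i → index (g (toℕ i)))
  ... | i , j , i<j , e with ℕ.m≤n⇒∃[o]m+o≡n i<j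
  ...   | d , i+1+d≡j = toℕ i , d , index-injective (trans e (cong (index ∘ g) j≡i+1+d))
    where
    j≡i+1+d : toℕ j ≡ toℕ i ℕ.+ suc d
    j≡i+1+d = trans (sym i+1+d≡j) (sym (ℕ.+-suc (toℕ i) d))

  ^-≢0 : ∀ {x} → x ≢ 0# → ∀ n → x ^ n ≢ 0#
  ^-≢0 x≢0 zero    = 1≢0
  ^-≢0 x≢0 (suc n) = *-≢0 x≢0 (^-≢0 x≢0 n)

  finite-order : ∀ {x} → x ≢ 0# → ∃ λ m → x ^ suc m ≡ 1#
  finite-order {x} x≢0 =
    let i , d , xⁱ≡xⁱ⁺ᵈ⁺¹ = repetition (x ^_)
    in d , sym (*-cancelˡ (^-≢0 x≢0 i) (begin
      x ^ i * 1#          ≡⟨ *-identityʳ (x ^ i) ⟩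
      x ^ i               ≡⟨ xⁱ≡xⁱ⁺ᵈ⁺¹ ⟩
      x ^ (i ℕ.+ suc d)   ≡⟨ ^-homo-* x i (suc d) ⟩
      x ^ i * x ^ suc d   ∎))
    where open ≡-Reasoning

  finite-characteristic : ∃ λ p → suc p ×1 ≡ 0#
  finite-characteristic =
    let i , d , iᶜ≡[i+d+1]ᶜ = repetition _×1
    in d , +-cancelˡ (begin
      i ×1 + suc d ×1     ≡⟨ ×1-homo-+ i (suc d) ⟨
      (i ℕ.+ suc d) ×1    ≡⟨ iᶜ≡[i+d+1]ᶜ ⟨
      i ×1                ≡⟨ +-identityʳ (i ×1) ⟨
      i ×1 + 0#           ∎)
    where open ≡-Reasoning

  -1≡×1 : ∃ λ p → p ×1 ≡ - 1#
  -1≡×1 = let p , [1+p]×1≡0 = finite-characteristic in p , (begin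
    p ×1                   ≡⟨ solve 1 (λ m → m := (:1 :+ m) :- :1) refl (p ×1) ⟩
    (1# + p ×1) - 1#       ≡⟨ cong (_- 1#) [1+p]×1≡0 ⟩
    0# - 1#                ≡⟨ +-identityˡ (- 1#) ⟩
    - 1#                   ∎)
    where open ≡-Reasoning

  square-*-square : ∀ {x y} → IsSquare x → IsSquare y → IsSquare (x * y)
  square-*-square (s , refl) (t , refl) =
    s * t , solve 2 (λ s t → (s :* t) :* (s :* t) := (s :* s) :* (t :* t)) refl s t

  square-*-nonsquare : ∀ {x y} → x ≢ 0# → IsSquare x → ¬ IsSquare y → ¬ IsSquare (x * y)
  square-*-nonsquare {y = y} x≢0 (s , refl) ¬□y (w , w²≡s²y) = ¬□y (w * s⁻¹ , (begin
    (w * s⁻¹) * (w * s⁻¹)         ≡⟨ solve 2 (λ w s⁻¹ → (w :* s⁻¹) :* (w :* s⁻¹)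
                                                    := (w :* w) :* (s⁻¹ :* s⁻¹)) refl w s⁻¹ ⟩
    (w * w) * (s⁻¹ * s⁻¹)         ≡⟨ cong (_* (s⁻¹ * s⁻¹)) w²≡s²y ⟩
    ((s * s) * y) * (s⁻¹ * s⁻¹)   ≡⟨ solve 3 (λ s s⁻¹ y → ((s :* s) :* y) :* (s⁻¹ :* s⁻¹)
                                                      := ((s :* s⁻¹) :* (s :* s⁻¹)) :* y) refl s s⁻¹ y ⟩
    ((s * s⁻¹) * (s * s⁻¹)) * y   ≡⟨ cong (λ u → (u * u) * y) ss⁻¹≡1 ⟩
    (1# * 1#) * y                 ≡⟨ solve 1 (λ y → (:1 :* :1) :* y := y) refl y ⟩
    y                             ∎))
    where
    open ≡-Reasoning
    s≢0 : s ≢ 0#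
    s≢0 refl = x≢0 (zeroˡ 0#)
    s⁻¹ = proj₁ (inverse s s≢0)
    ss⁻¹≡1 = proj₂ (inverse s s≢0)

  square-roots : ∀ {x y} → x * x ≡ y * y → y ≡ x ⊎ y ≡ - x
  square-roots {x} {y} x²≡y² with (x - y) ≟ 0#
  ... | yes x-y≡0 = inj₁ (sym (x-y≡0⇒x≡y x-y≡0))
  ... | no  x-y≢0 = inj₂ (+-inverseʳ-unique x y (x*y≡0⇒y≡0 x-y≢0 (begin
    (x - y) * (x + y)   ≡⟨ solve 2 (λ x y → (x :- y) :* (x :+ y) := x :* x :- y :* y) refl x y ⟩
    x * x - y * y       ≡⟨ cong (_- y * y) x²≡y² ⟩
    y * y - y * y       ≡⟨ -‿inverseʳ (y * y) ⟩
    0#                  ∎)))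
    where open ≡-Reasoning

  NonzeroSquare : Pred Carrier 0ℓ
  NonzeroSquare x = x ≢ 0# × IsSquare x

  nonzero? : Decidable (_≢ 0#)
  nonzero? x = ¬? (x ≟ 0#)

  nonzeroSquare? : Decidable NonzeroSquare
  nonzeroSquare? = nonzero? ∩? square?

  nonsquare? : Decidable (∁ IsSquare)
  nonsquare? = ∁? square?

  nonsquare⇒≢0 : ∀ {x} → ¬ IsSquare x → x ≢ 0#
  nonsquare⇒≢0 ¬□x refl = ¬□x (0# , zeroˡ 0#)

  -- Multiplication by n injects the nonzero squares, together with m, into the nonsquares.
  squares<nonsquares : ∀ {n m} → ¬ IsSquare n → ¬ IsSquare m → ¬ IsSquare (n * m) →
                       count nonzeroSquare? < count nonsquare?
  squares<nonsquares {n} {m} ¬□n ¬□m ¬□nm = begin-strict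
    count nonzeroSquare?                                <⟨ ℕ.m<m+n _ (count-pos (T? ∩? nonsquare?) (inj₂ refl , ¬□m)) ⟩
    count nonzeroSquare? ℕ.+ count (T? ∩? nonsquare?)   ≡⟨ cong (ℕ._+ count (T? ∩? nonsquare?)) (count-≐ _ _ T∩□≐) ⟩
    count (T? ∩? square?) ℕ.+ count (T? ∩? nonsquare?)  ≡⟨ count-split T? square? ⟨
    count T?                                            ≤⟨ count-≤-injectiveOn T? nonsquare? (n *_) n*T⊆¬□
                                                                                (λ _ _ → *-cancelˡ n≢0) ⟩
    count nonsquare?                                    ∎
    where
    open ℕ.≤-Reasoning
    n≢0 = nonsquare⇒≢0 ¬□n
    T? : Decidable (NonzeroSquare ∪ (_≡ m))
    T? = nonzeroSquare? ∪? (_≟ m)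
    T∩□≐ : NonzeroSquare ≐ (NonzeroSquare ∪ (_≡ m)) ∩ IsSquare
    T∩□≐ = (λ s → inj₁ s , proj₂ s) , λ { (inj₁ s , _) → s ; (inj₂ refl , □m) → ⊥-elim (¬□m □m) }
    n*T⊆¬□ : ∀ {x} → (NonzeroSquare ∪ (_≡ m)) x → ¬ IsSquare (n * x)
    n*T⊆¬□ (inj₁ (x≢0 , □x)) = subst (λ z → ¬ IsSquare z) (*-comm _ n) (square-*-nonsquare x≢0 □x ¬□n)
    n*T⊆¬□ (inj₂ refl)       = ¬□nm

  χ-0 : χ 0# ≡ 0ℤ
  χ-0 with 0# ≟ 0#
  ... | yes _  = refl
  ... | no 0≢0 = ⊥-elim (0≢0 refl)

  χ-square : ∀ {x} → x ≢ 0# → IsSquare x → χ x ≡ 1ℤ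
  χ-square {x} x≢0 □x with x ≟ 0#
  ... | yes x≡0 = ⊥-elim (x≢0 x≡0)
  ... | no _ with square? x
  ...   | yes _  = refl
  ...   | no ¬□x = ⊥-elim (¬□x □x)

  χ-nonsquare : ∀ {x} → ¬ IsSquare x → χ x ≡ -1ℤ
  χ-nonsquare {x} ¬□x with x ≟ 0#
  ... | yes x≡0 = ⊥-elim (nonsquare⇒≢0 ¬□x x≡0)
  ... | no _ with square? x
  ...   | yes □x = ⊥-elim (¬□x □x)
  ...   | no _   = refl

  χ-≢0 : ∀ {x} → χ x ≢ 0ℤ → x ≢ 0#
  χ-≢0 χx≢0 x≡0 = χx≢0 (trans (cong χ x≡0) χ-0)

  χ≡1⇒≢0 : ∀ {x} → χ x ≡ 1ℤ → x ≢ 0#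
  χ≡1⇒≢0 χx≡1 refl with trans (sym χx≡1) χ-0
  ... | ()

  χ[1-x]≢0⇒x≢1 : ∀ {x} → χ (1# - x) ≢ 0ℤ → x ≢ 1#
  χ[1-x]≢0⇒x≢1 χ[1-x]≢0 refl = χ[1-x]≢0 (trans (cong χ (-‿inverseʳ 1#)) χ-0)

  χ-nonzero : ∀ {x} → x ≢ 0# → χ x ≡ 1ℤ ⊎ χ x ≡ -1ℤ
  χ-nonzero {x} x≢0 with square? x
  ... | yes □x  = inj₁ (χ-square x≢0 □x)
  ... | no  ¬□x = inj₂ (χ-nonsquare ¬□x)

  square-trichotomy : ∀ x → x ≡ 0# ⊎ (x ≢ 0# × IsSquare x) ⊎ ¬ IsSquare x
  square-trichotomy x with x ≟ 0# | square? x
  ... | yes x≡0 | _      = inj₁ x≡0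
  ... | no x≢0  | yes □x = inj₂ (inj₁ (x≢0 , □x))
  ... | no _    | no ¬□x = inj₂ (inj₂ ¬□x)

  module _ (odd : size % 2 ≡ 1) where

    x≢-x : ∀ {x} → x ≢ 0# → x ≢ - x
    x≢-x {x} x≢0 x≡-x = 1+1≢0 odd (x*y≡0⇒y≡0 x≢0 (begin
      x * (1# + 1#)   ≡⟨ solve 1 (λ x → x :* (:1 :+ :1) := x :+ x) refl x ⟩
      x + x           ≡⟨ cong (x +_) x≡-x ⟩
      x - x           ≡⟨ -‿inverseʳ x ⟩
      0#              ∎))
      where open ≡-Reasoning

    -- Squaring is injective on each of the halves {x ≠ 0 | rank x < rank (- x)} and its complement.
    nonzero≤squares+squares : count nonzero? ℕ.≤ count nonzeroSquare? ℕ.+ count nonzeroSquare?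
    nonzero≤squares+squares = begin
      count nonzero?                                                 ≡⟨ count-split nonzero? Lower? ⟩
      count (nonzero? ∩? Lower?) ℕ.+ count (nonzero? ∩? ∁? Lower?)   ≤⟨ ℕ.+-mono-≤ (squaring _ proj₁ lower-injective)
                                                                                      (squaring _ proj₁ upper-injective) ⟩
      count nonzeroSquare? ℕ.+ count nonzeroSquare?                  ∎
      where
      open ℕ.≤-Reasoning
      Lower : Pred Carrier 0ℓ
      Lower x = rank x < rank (- x)
      Lower? : Decidable Lower
      Lower? x = rank x ℕ.<? rank (- x)
      squaring : ∀ {R : Pred Carrier 0ℓ} (R? : Decidable R) → (∀ {x} → R x → x ≢ 0#) →
                 (∀ {x y} → R x → R y → x * x ≡ y * y → x ≡ y) → count R? ℕ.≤ count nonzeroSquare?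
      squaring R? R⇒≢0 inj = count-≤-injectiveOn R? nonzeroSquare? (λ x → x * x)
        (λ {x} r → *-≢0 (R⇒≢0 r) (R⇒≢0 r) , x , refl) inj
      lower-injective : ∀ {x y} → (x ≢ 0# × Lower x) → (y ≢ 0# × Lower y) → x * x ≡ y * y → x ≡ y
      lower-injective {x} (_ , x<-x) (_ , y<-y) x²≡y² with square-roots x²≡y²
      ... | inj₁ y≡x = sym y≡x
      ... | inj₂ refl = ⊥-elim (ℕ.<-asym x<-x (subst (λ z → rank (- x) < rank z) (-‿involutive x) y<-y))
      upper-injective : ∀ {x y} → (x ≢ 0# × ¬ Lower x) → (y ≢ 0# × ¬ Lower y) → x * x ≡ y * y → x ≡ y
      upper-injective {x} (x≢0 , x≮-x) (_ , y≮-y) x²≡y² with square-roots x²≡y²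
      ... | inj₁ y≡x = sym y≡x
      ... | inj₂ refl = ⊥-elim (x≢-x x≢0 (rank-injective (ℕ.≤-antisym
              (ℕ.≮⇒≥ (subst (λ z → ¬ rank (- x) < rank z) (-‿involutive x) y≮-y)) (ℕ.≮⇒≥ x≮-x))))

    nonsquares≤squares : count nonsquare? ℕ.≤ count nonzeroSquare?
    nonsquares≤squares = ℕ.+-cancelˡ-≤ (count nonzeroSquare?) _ _ (begin
      count nonzeroSquare? ℕ.+ count nonsquare?                ≡⟨ cong (count nonzeroSquare? ℕ.+_) (count-≐ _ _ ¬□≐≢0∩¬□) ⟩
      count nonzeroSquare? ℕ.+ count (nonzero? ∩? nonsquare?)  ≡⟨ count-split nonzero? square? ⟨
      count nonzero?                                           ≤⟨ nonzero≤squares+squares ⟩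
      count nonzeroSquare? ℕ.+ count nonzeroSquare?            ∎)
      where
      open ℕ.≤-Reasoning
      ¬□≐≢0∩¬□ : ∁ IsSquare ≐ (_≢ 0#) ∩ ∁ IsSquare
      ¬□≐≢0∩¬□ = (λ ¬□ → nonsquare⇒≢0 ¬□ , ¬□) , proj₂

    nonsquare-*-nonsquare : ∀ {x y} → ¬ IsSquare x → ¬ IsSquare y → IsSquare (x * y)
    nonsquare-*-nonsquare {x} {y} ¬□x ¬□y with square? (x * y)
    ... | yes □xy = □xy
    ... | no ¬□xy = ⊥-elim (ℕ.<⇒≱ (squares<nonsquares ¬□x ¬□y ¬□xy) nonsquares≤squares)

    χ-* : ∀ x y → χ (x * y) ≡ χ x ℤ.* χ y
    χ-* x y with square-trichotomy x | square-trichotomy y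
    ... | inj₁ refl | _ =
      trans (cong χ (zeroˡ y)) (trans χ-0 (cong (ℤ._* χ y) (sym χ-0)))
    ... | inj₂ _ | inj₁ refl =
      trans (cong χ (zeroʳ x)) (trans χ-0 (trans (sym (ℤ.*-zeroʳ (χ x))) (cong (χ x ℤ.*_) (sym χ-0))))
    ... | inj₂ (inj₁ (x≢0 , □x)) | inj₂ (inj₁ (y≢0 , □y)) =
      trans (χ-square (*-≢0 x≢0 y≢0) (square-*-square □x □y))
            (sym (cong₂ ℤ._*_ (χ-square x≢0 □x) (χ-square y≢0 □y)))
    ... | inj₂ (inj₁ (x≢0 , □x)) | inj₂ (inj₂ ¬□y) =
      trans (χ-nonsquare (square-*-nonsquare x≢0 □x ¬□y))
            (sym (cong₂ ℤ._*_ (χ-square x≢0 □x) (χ-nonsquare ¬□y)))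
    ... | inj₂ (inj₂ ¬□x) | inj₂ (inj₁ (y≢0 , □y)) =
      trans (χ-nonsquare (subst (λ z → ¬ IsSquare z) (*-comm y x) (square-*-nonsquare y≢0 □y ¬□x)))
            (sym (cong₂ ℤ._*_ (χ-nonsquare ¬□x) (χ-square y≢0 □y)))
    ... | inj₂ (inj₂ ¬□x) | inj₂ (inj₂ ¬□y) =
      trans (χ-square (*-≢0 (nonsquare⇒≢0 ¬□x) (nonsquare⇒≢0 ¬□y)) (nonsquare-*-nonsquare ¬□x ¬□y))
            (sym (cong₂ ℤ._*_ (χ-nonsquare ¬□x) (χ-nonsquare ¬□y)))

module Homotheties (F : FiniteField) where
  open FiniteField F
  open FiniteFieldProperties F

  homothety : Carrier → Carrier → Carrier → Carrier
  homothety x r z = x + r * (z - x)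

  homothety-∘ : ∀ x r s z → homothety x r (homothety x s z) ≡ homothety x (r * s) z
  homothety-∘ = solve 4 (λ x r s z → x :+ r :* ((x :+ s :* (z :- x)) :- x) := x :+ (r :* s) :* (z :- x)) refl

  homothety-swap : ∀ x y c → homothety y c x ≡ homothety x (1# - c) y
  homothety-swap = solve 3 (λ x y c → y :+ c :* (x :- y) := x :+ (:1 :- c) :* (y :- x)) refl

  homothety-conj : ∀ x α z c w → homothety x α (homothety z c w) ≡ homothety (homothety x α z) c (homothety x α w)
  homothety-conj = solve 5 (λ x α z c w → x :+ α :* ((z :+ c :* (w :- z)) :- x)
                                       := (x :+ α :* (z :- x)) :+ c :* ((x :+ α :* (w :- x)) :- (x :+ α :* (z :- x)))) refl

  homothety-offset : ∀ x r z → homothety x r z - x ≡ r * (z - x)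
  homothety-offset = solve 3 (λ x r z → (x :+ r :* (z :- x)) :- x := r :* (z :- x)) refl

  homothety-inverse : ∀ {x r r⁻¹} → r * r⁻¹ ≡ 1# → ∀ z → homothety x r (homothety x r⁻¹ z) ≡ z
  homothety-inverse {x} {r} {r⁻¹} rr⁻¹≡1 z = begin
    homothety x r (homothety x r⁻¹ z)  ≡⟨ homothety-∘ x r r⁻¹ z ⟩
    homothety x (r * r⁻¹) z            ≡⟨ cong (λ u → homothety x u z) rr⁻¹≡1 ⟩
    homothety x 1# z                   ≡⟨ solve 2 (λ x z → x :+ :1 :* (z :- x) := z) refl x z ⟩
    z                                  ∎
    where open ≡-Reasoning

  homothety-inverse-translation : ∀ {x y s s⁻¹} → s * s⁻¹ ≡ 1# → ∀ z →
    homothety y s (homothety x s⁻¹ z) ≡ z + (1# - s) * (y - x)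
  homothety-inverse-translation {x} {y} {s} {s⁻¹} ss⁻¹≡1 z = begin
    homothety y s (homothety x s⁻¹ z)      ≡⟨ solve 5 (λ x y s s⁻¹ z → y :+ s :* ((x :+ s⁻¹ :* (z :- x)) :- y)
                                                         := y :+ s :* (x :- y) :+ (s :* s⁻¹) :* (z :- x)) refl x y s s⁻¹ z ⟩
    y + s * (x - y) + (s * s⁻¹) * (z - x)  ≡⟨ cong (λ u → y + s * (x - y) + u * (z - x)) ss⁻¹≡1 ⟩
    y + s * (x - y) + 1# * (z - x)         ≡⟨ solve 4 (λ x y s z → y :+ s :* (x :- y) :+ :1 :* (z :- x)
                                                         := z :+ (:1 :- s) :* (y :- x)) refl x y s z ⟩
    z + (1# - s) * (y - x)                 ∎
    where open ≡-Reasoning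

  Invariant : Subset → (Carrier → Carrier) → Set
  Invariant S f = ∀ z → z ∈ S → f z ∈ S

  IsPeriod : Subset → Carrier → Set
  IsPeriod S t = Invariant S (_+ t)

  ScalesPeriods : Subset → Carrier → Set
  ScalesPeriods S c = ∀ t → IsPeriod S t → IsPeriod S (c * t)

  ProperHomothetyAt : Subset → Carrier → Set
  ProperHomothetyAt S x = ∃ λ r → r ≢ 0# × r ≢ 1# × Invariant S (homothety x r)

  HasProperHomotheties : Subset → Set
  HasProperHomotheties S = ∀ x y → x ∈ S → y ∈ S → x ≢ y → ProperHomothetyAt S x

  invariant-≗ : ∀ {S f g} → (∀ z → f z ≡ g z) → Invariant S f → Invariant S g
  invariant-≗ {S} f≗g f[S]⊆S z z∈S = subst (_∈ S) (f≗g z) (f[S]⊆S z z∈S)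

  isPeriod-0 : ∀ {S} → IsPeriod S 0#
  isPeriod-0 = invariant-≗ (λ z → sym (+-identityʳ z)) (λ _ z∈S → z∈S)

  isPeriod-+ : ∀ {S t u} → IsPeriod S t → IsPeriod S u → IsPeriod S (t + u)
  isPeriod-+ {S} {t} {u} pt pu z z∈S = subst (_∈ S) (+-assoc z t u) (pu _ (pt z z∈S))

  isPeriod-×1 : ∀ {S t} → IsPeriod S t → ∀ n → IsPeriod S (n ×1 * t)
  isPeriod-×1 {S} {t} pt zero    = invariant-≗ (λ z → cong (z +_) (sym (zeroˡ t))) isPeriod-0
  isPeriod-×1 {S} {t} pt (suc n) =
    invariant-≗ (λ z → cong (z +_) (solve 2 (λ t m → t :+ m :* t := (:1 :+ m) :* t) refl t (n ×1)))
                (isPeriod-+ pt (isPeriod-×1 pt n))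

  isPeriod-neg : ∀ {S t} → IsPeriod S t → IsPeriod S (- t)
  isPeriod-neg {S} {t} pt = let p , p×1≡-1 = -1≡×1 in
    invariant-≗ (λ z → cong (z +_) (trans (cong (_* t) p×1≡-1) (solve 1 (λ t → (:- :1) :* t := :- t) refl t)))
                (isPeriod-×1 pt p)

  invariant-^ : ∀ {S x r} → Invariant S (homothety x r) → ∀ k → Invariant S (homothety x (r ^ k))
  invariant-^ {S} {x} {r} inv zero = invariant-≗ (λ z → solve 2 (λ x z → z := x :+ :1 :* (z :- x)) refl x z) (λ _ z∈S → z∈S)
  invariant-^ {S} {x} {r} inv (suc k) z z∈S = subst (_∈ S) (homothety-∘ x r (r ^ k) z) (inv _ (invariant-^ inv k z z∈S))

  invariant-inverse : ∀ {S x r} → r ≢ 0# → Invariant S (homothety x r) →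
                      ∃ λ r⁻¹ → r * r⁻¹ ≡ 1# × Invariant S (homothety x r⁻¹)
  invariant-inverse r≢0 inv = let m , r¹⁺ᵐ≡1 = finite-order r≢0 in _ , r¹⁺ᵐ≡1 , invariant-^ inv m

  -- Conjugating the translation by t with a homothety of ratio r gives the translation by r t.
  homothety⇒scalesPeriods : ∀ {S x r r⁻¹} → r * r⁻¹ ≡ 1# →
    Invariant S (homothety x r) → Invariant S (homothety x r⁻¹) → ScalesPeriods S r
  homothety⇒scalesPeriods {S} {x} {r} {r⁻¹} rr⁻¹≡1 inv inv⁻¹ t pt z z∈S =
    subst (_∈ S) conjugate (inv _ (pt _ (inv⁻¹ z z∈S)))
    where
    open ≡-Reasoning
    conjugate : homothety x r (homothety x r⁻¹ z + t) ≡ z + r * t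
    conjugate = begin
      homothety x r (homothety x r⁻¹ z + t)
        ≡⟨ solve 5 (λ x r r⁻¹ z t → x :+ r :* ((x :+ r⁻¹ :* (z :- x) :+ t) :- x)
                                  := x :+ (r :* r⁻¹) :* (z :- x) :+ r :* t) refl x r r⁻¹ z t ⟩
      x + (r * r⁻¹) * (z - x) + r * t  ≡⟨ cong (λ u → x + u * (z - x) + r * t) rr⁻¹≡1 ⟩
      x + 1# * (z - x) + r * t         ≡⟨ solve 4 (λ x z r t → x :+ :1 :* (z :- x) :+ r :* t := z :+ r :* t) refl x z r t ⟩
      z + r * t                        ∎

  scalesPeriods-1- : ∀ {S r} → ScalesPeriods S r → ScalesPeriods S (1# - r)
  scalesPeriods-1- {r = r} sr t pt =
    invariant-≗ (λ z → cong (z +_) (solve 2 (λ r t → t :+ :- (r :* t) := (:1 :- r) :* t) refl r t))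
                (isPeriod-+ pt (isPeriod-neg (sr t pt)))

  scalesPeriods-^ : ∀ {S c} → ScalesPeriods S c → ∀ k → ScalesPeriods S (c ^ k)
  scalesPeriods-^ sc zero    t pt = invariant-≗ (λ z → cong (z +_) (sym (*-identityˡ t))) pt
  scalesPeriods-^ {c = c} sc (suc k) t pt =
    invariant-≗ (λ z → cong (z +_) (sym (*-assoc c (c ^ k) t))) (sc _ (scalesPeriods-^ sc k t pt))

  scalesPeriods-cancel : ∀ {S c t} → c ≢ 0# → ScalesPeriods S c → IsPeriod S (c * t) → IsPeriod S t
  scalesPeriods-cancel {c = c} {t} c≢0 sc pct = let m , c¹⁺ᵐ≡1 = finite-order c≢0 in
    invariant-≗ (λ z → cong (z +_) (begin
        c ^ m * (c * t)     ≡⟨ solve 3 (λ cᵐ c t → cᵐ :* (c :* t) := (c :* cᵐ) :* t) refl (c ^ m) c t ⟩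
        (c * c ^ m) * t     ≡⟨ cong (_* t) c¹⁺ᵐ≡1 ⟩
        1# * t              ≡⟨ *-identityˡ t ⟩
        t                   ∎))
      (scalesPeriods-^ sc m _ pct)
    where open ≡-Reasoning

  commutator-isPeriod : ∀ {S x y r r⁻¹ s s⁻¹} → r * r⁻¹ ≡ 1# → s * s⁻¹ ≡ 1# →
    Invariant S (homothety x r) → Invariant S (homothety x r⁻¹) →
    Invariant S (homothety y s) → Invariant S (homothety y s⁻¹) →
    IsPeriod S ((1# - s) * ((1# - r) * (y - x)))
  commutator-isPeriod {S} {x} {y} {r} {r⁻¹} {s} {s⁻¹} rr⁻¹≡1 ss⁻¹≡1 inv-r inv-r⁻¹ inv-s inv-s⁻¹ z z∈S =
    subst (_∈ S) commutator (inv-s _ (inv-r _ (inv-s⁻¹ _ (inv-r⁻¹ z z∈S))))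
    where
    open ≡-Reasoning
    y′ = homothety x r y
    commutator : homothety y s (homothety x r (homothety y s⁻¹ (homothety x r⁻¹ z)))
               ≡ z + (1# - s) * ((1# - r) * (y - x))
    commutator = begin
      homothety y s (homothety x r (homothety y s⁻¹ (homothety x r⁻¹ z)))
        ≡⟨ cong (homothety y s) (homothety-conj x r y s⁻¹ _) ⟩
      homothety y s (homothety y′ s⁻¹ (homothety x r (homothety x r⁻¹ z)))
        ≡⟨ cong (λ w → homothety y s (homothety y′ s⁻¹ w)) (homothety-inverse rr⁻¹≡1 z) ⟩
      homothety y s (homothety y′ s⁻¹ z)
        ≡⟨ homothety-inverse-translation ss⁻¹≡1 z ⟩
      z + (1# - s) * (y - y′)
        ≡⟨ cong (λ u → z + (1# - s) * u) (solve 3 (λ x y r → y :- (x :+ r :* (y :- x)) := (:1 :- r) :* (y :- x)) refl x y r) ⟩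
      z + (1# - s) * ((1# - r) * (y - x))
        ∎

  properHomotheties⇒isPeriod : ∀ {S x y} → ProperHomothetyAt S x → ProperHomothetyAt S y → IsPeriod S (y - x)
  properHomotheties⇒isPeriod (r , r≢0 , r≢1 , inv-r) (s , s≢0 , s≢1 , inv-s) =
    let r⁻¹ , rr⁻¹≡1 , inv-r⁻¹ = invariant-inverse r≢0 inv-r
        s⁻¹ , ss⁻¹≡1 , inv-s⁻¹ = invariant-inverse s≢0 inv-s
    in scalesPeriods-cancel (1-x≢0 r≢1) (scalesPeriods-1- (homothety⇒scalesPeriods rr⁻¹≡1 inv-r inv-r⁻¹))
         (scalesPeriods-cancel (1-x≢0 s≢1) (scalesPeriods-1- (homothety⇒scalesPeriods ss⁻¹≡1 inv-s inv-s⁻¹))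
           (commutator-isPeriod rr⁻¹≡1 ss⁻¹≡1 inv-r inv-r⁻¹ inv-s inv-s⁻¹))

  differences-isPeriod : ∀ {S x y} → HasProperHomotheties S → x ∈ S → y ∈ S → IsPeriod S (y - x)
  differences-isPeriod {S} {x} {y} H x∈S y∈S with x ≟ y
  ... | yes refl = invariant-≗ (λ z → cong (z +_) (sym (-‿inverseʳ x))) isPeriod-0
  ... | no x≢y   = properHomotheties⇒isPeriod (H x y x∈S y∈S x≢y) (H y x y∈S x∈S (λ y≡x → x≢y (sym y≡x)))

  properHomotheties⇒coset : ∀ {S x₀} → HasProperHomotheties S → x₀ ∈ S → IsCosetOfSubspace S
  properHomotheties⇒coset {S} {x₀} H x₀∈S =
    V , (0∈V , +-closed , ×1-closed) , x₀ , λ x → cong S (solve 2 (λ x x₀ → x := (x :- x₀) :+ x₀) refl x x₀)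
    where
    V : Subset
    V t = S (t + x₀)
    isPeriod : ∀ {v} → v ∈ V → IsPeriod S v
    isPeriod {v} v∈V = invariant-≗ (λ z → cong (z +_) (solve 2 (λ v x₀ → (v :+ x₀) :- x₀ := v) refl v x₀))
                                   (differences-isPeriod H x₀∈S v∈V)
    0∈V : 0# ∈ V
    0∈V = subst (_∈ S) (sym (+-identityˡ x₀)) x₀∈S
    +-closed : ∀ u v → u ∈ V → v ∈ V → (u + v) ∈ V
    +-closed u v u∈V v∈V = subst (_∈ S) (solve 3 (λ u v x₀ → (v :+ x₀) :+ u := (u :+ v) :+ x₀) refl u v x₀)
                                 (isPeriod u∈V (v + x₀) v∈V)
    ×1-closed : ∀ n v → v ∈ V → (n ×1 * v) ∈ V
    ×1-closed n v v∈V = subst (_∈ S) (+-comm x₀ (n ×1 * v)) (isPeriod-×1 (isPeriod v∈V) n x₀ x₀∈S)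

module QuadraticQuasigroup (F : FiniteField) (odd : FiniteField.size F % 2 ≡ 1)
                           {a b : FiniteField.Carrier F} (parameters : FiniteField.QuadraticParameters F a b) where
  open FiniteField F
  open FiniteFieldProperties F
  open Homotheties F

  χa≡χb : χ a ≡ χ b
  χa≡χb = proj₁ parameters

  χa≢0 : χ a ≢ 0ℤ
  χa≢0 = proj₁ (proj₂ parameters)

  χ[1-a]≡χ[1-b] : χ (1# - a) ≡ χ (1# - b)
  χ[1-a]≡χ[1-b] = proj₁ (proj₂ (proj₂ parameters))

  χ[1-a]≢0 : χ (1# - a) ≢ 0ℤ
  χ[1-a]≢0 = proj₂ (proj₂ (proj₂ parameters))

  a≢0 : a ≢ 0#
  a≢0 = χ-≢0 χa≢0

  a≢1 : a ≢ 1#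
  a≢1 = χ[1-x]≢0⇒x≢1 χ[1-a]≢0

  b≢0 : b ≢ 0#
  b≢0 = χ-≢0 (λ χb≡0 → χa≢0 (trans χa≡χb χb≡0))

  ratio : ℤ → Carrier
  ratio c = if does (ℤ.+ 0 ℤ.≤? c) then a else b

  qop-homothety : ∀ x y → qop a b x y ≡ homothety x (ratio (χ (y - x))) y
  qop-homothety x y with does (ℤ.+ 0 ℤ.≤? χ (y - x))
  ... | true  = refl
  ... | false = refl

  ratio-cases : ∀ c → ratio c ≡ a ⊎ ratio c ≡ b
  ratio-cases c with does (ℤ.+ 0 ℤ.≤? c)
  ... | true  = inj₁ refl
  ... | false = inj₂ refl

  χ-ratio : ∀ c → χ (ratio c) ≡ χ a
  χ-ratio c with ratio-cases c
  ... | inj₁ ratio≡a = cong χ ratio≡a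
  ... | inj₂ ratio≡b = trans (cong χ ratio≡b) (sym χa≡χb)

  χ-1-ratio : ∀ c → χ (1# - ratio c) ≡ χ (1# - a)
  χ-1-ratio c with ratio-cases c
  ... | inj₁ ratio≡a = cong (λ r → χ (1# - r)) ratio≡a
  ... | inj₂ ratio≡b = trans (cong (λ r → χ (1# - r)) ratio≡b) (sym χ[1-a]≡χ[1-b])

  ratio-≢0 : ∀ c → ratio c ≢ 0#
  ratio-≢0 c = χ-≢0 (λ χr≡0 → χa≢0 (trans (sym (χ-ratio c)) χr≡0))

  ratio-≢1 : ∀ c → ratio c ≢ 1#
  ratio-≢1 c = χ[1-x]≢0⇒x≢1 (λ χ[1-r]≡0 → χ[1-a]≢0 (trans (sym (χ-1-ratio c)) χ[1-r]≡0))

  χ-homothety-difference : ∀ {α} → χ α ≡ 1ℤ → ∀ x z w → χ (homothety x α w - homothety x α z) ≡ χ (w - z)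
  χ-homothety-difference {α} χα≡1 x z w = begin
    χ (homothety x α w - homothety x α z)  ≡⟨ cong χ (solve 4 (λ x α z w → (x :+ α :* (w :- x)) :- (x :+ α :* (z :- x))
                                                                   := α :* (w :- z)) refl x α z w) ⟩
    χ (α * (w - z))                        ≡⟨ χ-* odd α (w - z) ⟩
    χ α ℤ.* χ (w - z)                      ≡⟨ cong (ℤ._* χ (w - z)) χα≡1 ⟩
    1ℤ ℤ.* χ (w - z)                       ≡⟨ ℤ.*-identityˡ (χ (w - z)) ⟩
    χ (w - z)                              ∎
    where open ≡-Reasoning

  homothety-automorphism : ∀ {α} → χ α ≡ 1ℤ → ∀ x z w →
    homothety x α (qop a b z w) ≡ qop a b (homothety x α z) (homothety x α w)
  homothety-automorphism {α} χα≡1 x z w = begin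
    h (qop a b z w)                            ≡⟨ cong h (qop-homothety z w) ⟩
    h (homothety z (ratio (χ (w - z))) w)      ≡⟨ homothety-conj x α z _ w ⟩
    homothety (h z) (ratio (χ (w - z))) (h w)  ≡⟨ cong (λ c → homothety (h z) (ratio c) (h w))
                                                       (χ-homothety-difference χα≡1 x z w) ⟨
    homothety (h z) (ratio (χ (h w - h z))) (h w) ≡⟨ qop-homothety (h z) (h w) ⟨
    qop a b (h z) (h w)                        ∎
    where
    open ≡-Reasoning
    h = homothety x α

  -- S ∩ h⁻¹(S) is a subquasigroup containing x and y, so by minimality it is all of S.
  minimal⇒invariant : ∀ {S x y α} → IsMinimalSubquasigroup a b S → x ∈ S → y ∈ S → x ≢ y →
                      χ α ≡ 1ℤ → homothety x α y ∈ S → Invariant S (homothety x α)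
  minimal⇒invariant {S} {x} {y} {α} (closed , _ , minimal) x∈S y∈S x≢y χα≡1 hy∈S z z∈S
    with S (homothety x α z) in hz∈S
  ... | true  = refl
  ... | false = ⊥-elim (x≢y (minimal W W-closed (W⊆S , z , z∈S , z∉W) x y x∈W y∈W))
    where
    h = homothety x α
    W : Subset
    W u = S u ∧ S (h u)
    ∧-true : ∀ {p q} → p ∧ q ≡ true → p ≡ true × q ≡ true
    ∧-true {true} q≡true = refl , q≡true
    true-∧ : ∀ {p q} → p ≡ true → q ≡ true → p ∧ q ≡ true
    true-∧ refl q≡true = q≡true
    W⊆S : W ⊆ S
    W⊆S u u∈W = proj₁ (∧-true u∈W)
    z∉W : ¬ z ∈ W
    z∉W z∈W with trans (sym hz∈S) (proj₂ (∧-true {S z} z∈W))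
    ... | ()
    x∈W : x ∈ W
    x∈W = true-∧ x∈S (subst (_∈ S) (solve 2 (λ x α → x := x :+ α :* (x :- x)) refl x α) x∈S)
    y∈W : y ∈ W
    y∈W = true-∧ y∈S hy∈S
    W-closed : IsSubquasigroup a b W
    W-closed u v u∈W v∈W = true-∧ (closed u v (proj₁ (∧-true u∈W)) (proj₁ (∧-true v∈W)))
      (subst (_∈ S) (sym (homothety-automorphism χα≡1 x u v)) (closed _ _ (proj₂ (∧-true {S u} u∈W)) (proj₂ (∧-true {S v} v∈W))))

  ratio-twice : χ a ≡ -1ℤ → ∀ {d} → d ≢ 0# → ratio (χ (ratio (χ d) * d)) * ratio (χ d) ≡ a * b
  ratio-twice χa≡-1 {d} d≢0 with χ-nonzero d≢0
  ... | inj₁ χd≡1 rewrite χd≡1 =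
    trans (cong (λ c → ratio c * a) (trans (χ-* odd a d) (cong₂ ℤ._*_ χa≡-1 χd≡1))) (*-comm b a)
  ... | inj₂ χd≡-1 rewrite χd≡-1 =
    cong (λ c → ratio c * b) (trans (χ-* odd b d) (cong₂ ℤ._*_ (trans (sym χa≡χb) χa≡-1) χd≡-1))

  χ-1≡-1 : χ a ≡ -1ℤ → a * b ≡ 1# → χ (1# - a) ≡ -1ℤ → χ (- 1#) ≡ -1ℤ
  χ-1≡-1 χa≡-1 ab≡1 χ[1-a]≡-1 = begin
    χ (- 1#)                                ≡⟨ ℤ.*-identityʳ (χ (- 1#)) ⟨
    χ (- 1#) ℤ.* 1ℤ                         ≡⟨ cong (χ (- 1#) ℤ.*_) χ[[1-a]b]≡1 ⟨
    χ (- 1#) ℤ.* χ ((1# - a) * b)           ≡⟨ χ-* odd (- 1#) ((1# - a) * b) ⟨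
    χ (- 1# * ((1# - a) * b))               ≡⟨ cong χ (solve 2 (λ a b → (:- :1) :* ((:1 :- a) :* b) := a :* b :- b) refl a b) ⟩
    χ (a * b - b)                           ≡⟨ cong (λ u → χ (u - b)) ab≡1 ⟩
    χ (1# - b)                              ≡⟨ χ[1-a]≡χ[1-b] ⟨
    χ (1# - a)                              ≡⟨ χ[1-a]≡-1 ⟩
    -1ℤ                                     ∎
    where
    open ≡-Reasoning
    χ[[1-a]b]≡1 : χ ((1# - a) * b) ≡ 1ℤ
    χ[[1-a]b]≡1 = trans (χ-* odd (1# - a) b) (cong₂ ℤ._*_ χ[1-a]≡-1 (trans (sym χa≡χb) χa≡-1))

  χ-reverse : ∀ {c} → χ (- 1#) ≡ -1ℤ → χ c ≡ -1ℤ → ∀ x y → χ (x - homothety x c y) ≡ χ (y - x)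
  χ-reverse {c} χ[-1]≡-1 χc≡-1 x y = begin
    χ (x - homothety x c y)               ≡⟨ cong χ (solve 3 (λ x y c → x :- (x :+ c :* (y :- x)) := (:- :1) :* (c :* (y :- x)))
                                                              refl x y c) ⟩
    χ (- 1# * (c * (y - x)))              ≡⟨ χ-* odd (- 1#) (c * (y - x)) ⟩
    χ (- 1#) ℤ.* χ (c * (y - x))          ≡⟨ cong (χ (- 1#) ℤ.*_) (χ-* odd c (y - x)) ⟩
    χ (- 1#) ℤ.* (χ c ℤ.* χ (y - x))      ≡⟨ cong₂ (λ u v → u ℤ.* (v ℤ.* χ (y - x))) χ[-1]≡-1 χc≡-1 ⟩
    -1ℤ ℤ.* (-1ℤ ℤ.* χ (y - x))           ≡⟨ ℤ.*-assoc -1ℤ -1ℤ (χ (y - x)) ⟨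
    1ℤ ℤ.* χ (y - x)                      ≡⟨ ℤ.*-identityˡ (χ (y - x)) ⟩
    χ (y - x)                             ∎
    where open ≡-Reasoning

  ratio-ratio²≢1 : a * b ≡ 1# → a + b ≢ 1# → ∀ d → ratio d - ratio d * ratio d ≢ 1#
  ratio-ratio²≢1 ab≡1 a+b≢1 d r≡1 with ratio-cases d
  ... | inj₁ c≡a = a+b≢1 (x*y≡1∧x-x*x≡1⇒x+y≡1 ab≡1 (subst (λ u → u - u * u ≡ 1#) c≡a r≡1))
  ... | inj₂ c≡b = a+b≢1 (trans (+-comm a b)
          (x*y≡1∧x-x*x≡1⇒x+y≡1 (trans (*-comm b a) ab≡1) (subst (λ u → u - u * u ≡ 1#) c≡b r≡1)))

  ExceptionalRatios : Set
  ExceptionalRatios = a * b ≡ 1# × a + b ≡ 1# × χ a ≡ -1ℤ × χ (1# - a) ≡ -1ℤ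

  exceptional? : Dec ExceptionalRatios
  exceptional? = ((a * b) ≟ 1#) ×-dec ((a + b) ≟ 1#) ×-dec (χ a ℤ.≟ -1ℤ) ×-dec (χ (1# - a) ℤ.≟ -1ℤ)

  exceptionalRatios⇒exceptional : ExceptionalRatios → Exceptional a b
  exceptionalRatios⇒exceptional (ab≡1 , a+b≡1 , χa≡-1 , χ[1-a]≡-1) =
    ab≡1 , a+b≡1 ,
    x+y≡1∧x*y≡1⇒x-x*x≡1 a+b≡1 ab≡1 , x+y≡1∧x*y≡1⇒x-x*x≡1 b+a≡1 ba≡1 ,
    x+y≡1∧x*y≡1⇒-x*x*x≡1 a+b≡1 ab≡1 , x+y≡1∧x*y≡1⇒-x*x*x≡1 b+a≡1 ba≡1 ,
    χa≡-1 , trans (sym χa≡χb) χa≡-1 , χ[1-a]≡-1 , trans (sym χ[1-a]≡χ[1-b]) χ[1-a]≡-1 ,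
    χ-1≡-1 χa≡-1 ab≡1 χ[1-a]≡-1
    where
    b+a≡1 = trans (+-comm b a) a+b≡1
    ba≡1 = trans (*-comm b a) ab≡1

  exceptionalRatios-char3⇒a≡b : HasCharacteristic 3 → ExceptionalRatios → a ≡ b
  exceptionalRatios-char3⇒a≡b (_ , 3≡0 , _) (ab≡1 , a+b≡1 , _) = x+y≡1∧x*y≡1⇒x≡y 3≡0 a+b≡1 ab≡1

  module _ {S} (minimalS : IsMinimalSubquasigroup a b S) {x y} (x∈S : x ∈ S) (y∈S : y ∈ S) (x≢y : x ≢ y) where

    private
      closed : IsSubquasigroup a b S
      closed = proj₁ minimalS
      y-x≢0 : y - x ≢ 0#
      y-x≢0 y-x≡0 = x≢y (sym (x-y≡0⇒x≡y y-x≡0))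
      δ : ℤ
      δ = χ (y - x)
      c : Carrier
      c = ratio δ
      x*y∈S : homothety x c y ∈ S
      x*y∈S = subst (_∈ S) (qop-homothety x y) (closed x y x∈S y∈S)
      invariant : ∀ {α} → χ α ≡ 1ℤ → homothety x α y ∈ S → Invariant S (homothety x α)
      invariant = minimal⇒invariant minimalS x∈S y∈S x≢y
      open ≡-Reasoning

    square-case : χ a ≡ 1ℤ → ProperHomothetyAt S x
    square-case χa≡1 = c , ratio-≢0 δ , ratio-≢1 δ , invariant (trans (χ-ratio δ) χa≡1) x*y∈S

    product-case : χ a ≡ -1ℤ → a * b ≢ 1# → ProperHomothetyAt S x
    product-case χa≡-1 ab≢1 =
      a * b , *-≢0 a≢0 b≢0 , ab≢1 , invariant χab≡1 (subst (_∈ S) x*[x*y] (closed x _ x∈S x*y∈S))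
      where
      χab≡1 : χ (a * b) ≡ 1ℤ
      χab≡1 = trans (χ-* odd a b) (cong₂ ℤ._*_ χa≡-1 (trans (sym χa≡χb) χa≡-1))
      x*[x*y] : qop a b x (homothety x c y) ≡ homothety x (a * b) y
      x*[x*y] = begin
        qop a b x (homothety x c y)                                   ≡⟨ qop-homothety x _ ⟩
        homothety x (ratio (χ (homothety x c y - x))) (homothety x c y) ≡⟨ cong (λ e → homothety x (ratio (χ e)) (homothety x c y))
                                                                               (homothety-offset x c y) ⟩
        homothety x (ratio (χ (c * (y - x)))) (homothety x c y)       ≡⟨ homothety-∘ x _ c y ⟩
        homothety x (ratio (χ (c * (y - x))) * c) y                   ≡⟨ cong (λ r → homothety x r y) (ratio-twice χa≡-1 y-x≢0) ⟩
        homothety x (a * b) y                                         ∎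

    complement-case : χ (1# - a) ≡ 1ℤ → ProperHomothetyAt S x
    complement-case χ[1-a]≡1 =
      1# - c′ , 1-x≢0 (ratio-≢1 (χ (x - y))) , 1-x≢1 (ratio-≢0 (χ (x - y))) ,
      invariant (trans (χ-1-ratio (χ (x - y))) χ[1-a]≡1)
                (subst (_∈ S) (trans (qop-homothety y x) (homothety-swap x y c′)) (closed y x y∈S x∈S))
      where
      c′ = ratio (χ (x - y))

    cubic-case : χ a ≡ -1ℤ → a * b ≡ 1# → χ (1# - a) ≡ -1ℤ → a + b ≢ 1# → ProperHomothetyAt S x
    cubic-case χa≡-1 ab≡1 χ[1-a]≡-1 a+b≢1 =
      c - c * c , χ≡1⇒≢0 χr≡1 , ratio-ratio²≢1 ab≡1 a+b≢1 δ ,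
      invariant χr≡1 (subst (_∈ S) [x*y]*x (closed _ x x*y∈S x∈S))
      where
      χc≡-1 : χ c ≡ -1ℤ
      χc≡-1 = trans (χ-ratio δ) χa≡-1
      χ[-1]≡-1 : χ (- 1#) ≡ -1ℤ
      χ[-1]≡-1 = χ-1≡-1 χa≡-1 ab≡1 χ[1-a]≡-1
      χr≡1 : χ (c - c * c) ≡ 1ℤ
      χr≡1 = begin
        χ (c - c * c)         ≡⟨ cong χ (solve 1 (λ c → c :- c :* c := c :* (:1 :- c)) refl c) ⟩
        χ (c * (1# - c))      ≡⟨ χ-* odd c (1# - c) ⟩
        χ c ℤ.* χ (1# - c)    ≡⟨ cong₂ ℤ._*_ χc≡-1 (trans (χ-1-ratio δ) χ[1-a]≡-1) ⟩
        1ℤ                    ∎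
      [x*y]*x : qop a b (homothety x c y) x ≡ homothety x (c - c * c) y
      [x*y]*x = begin
        qop a b (homothety x c y) x
          ≡⟨ qop-homothety _ x ⟩
        homothety (homothety x c y) (ratio (χ (x - homothety x c y))) x
          ≡⟨ cong (λ e → homothety (homothety x c y) (ratio e) x) (χ-reverse χ[-1]≡-1 χc≡-1 x y) ⟩
        homothety (homothety x c y) c x
          ≡⟨ solve 3 (λ x y c → (x :+ c :* (y :- x)) :+ c :* (x :- (x :+ c :* (y :- x)))
                                := x :+ (c :- c :* c) :* (y :- x)) refl x y c ⟩
        homothety x (c - c * c) y
          ∎

  minimal⇒properHomotheties : ¬ ExceptionalRatios → ∀ {S} → IsMinimalSubquasigroup a b S → HasProperHomotheties S
  minimal⇒properHomotheties ¬exceptional minimalS x y x∈S y∈S x≢y with χ-nonzero a≢0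
  ... | inj₁ χa≡1 = square-case minimalS x∈S y∈S x≢y χa≡1
  ... | inj₂ χa≡-1 with (a * b) ≟ 1#
  ...   | no ab≢1 = product-case minimalS x∈S y∈S x≢y χa≡-1 ab≢1
  ...   | yes ab≡1 with χ-nonzero (1-x≢0 a≢1)
  ...     | inj₁ χ[1-a]≡1 = complement-case minimalS x∈S y∈S x≢y χ[1-a]≡1
  ...     | inj₂ χ[1-a]≡-1 with (a + b) ≟ 1#
  ...       | yes a+b≡1 = ⊥-elim (¬exceptional (ab≡1 , a+b≡1 , χa≡-1 , χ[1-a]≡-1))
  ...       | no  a+b≢1 = cubic-case minimalS x∈S y∈S x≢y χa≡-1 ab≡1 χ[1-a]≡-1 a+b≢1

  a≡b⇒properHomotheties : a ≡ b → ∀ {S} → IsSubquasigroup a b S → HasProperHomotheties S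
  a≡b⇒properHomotheties a≡b {S} closed x _ x∈S _ _ =
    a , a≢0 , a≢1 , λ z z∈S →
      subst (_∈ S) (trans (qop-homothety x z) (cong (λ r → homothety x r z) (ratio≡a (χ (z - x))))) (closed x z x∈S z∈S)
    where
    ratio≡a : ∀ c → ratio c ≡ a
    ratio≡a c with ratio-cases c
    ... | inj₁ ratio≡a = ratio≡a
    ... | inj₂ ratio≡b = trans ratio≡b (sym a≡b)

  everyMinimalIsCoset : a ≡ b ⊎ ¬ ExceptionalRatios → EveryMinimalIsCoset a b
  everyMinimalIsCoset equal⊎¬exceptional S minimalS =
    properHomotheties⇒coset properHomotheties (proj₂ (nontrivial⇒inhabited (proj₁ (proj₂ minimalS))))
    where
    properHomotheties : HasProperHomotheties S
    properHomotheties = [ (λ a≡b → a≡b⇒properHomotheties a≡b (proj₁ minimalS))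
                        , (λ ¬exceptional → minimal⇒properHomotheties ¬exceptional minimalS) ] equal⊎¬exceptional

  everyMinimalIsCoset⊎exceptional : EveryMinimalIsCoset a b ⊎ (a ≢ b × ExceptionalRatios)
  everyMinimalIsCoset⊎exceptional with a ≟ b | exceptional?
  ... | yes a≡b | _               = inj₁ (everyMinimalIsCoset (inj₁ a≡b))
  ... | no  a≢b | yes exceptional = inj₂ (a≢b , exceptional)
  ... | no  _   | no ¬exceptional = inj₁ (everyMinimalIsCoset (inj₂ ¬exceptional))

proposition3p4 : (F : FiniteField) → let open FiniteField F in
    size % 2 ≡ 1 →
    (a b : Carrier) → QuadraticParameters a b →
    (HasCharacteristic 3 → EveryMinimalIsCoset a b) ×
    (¬ HasCharacteristic 3 → EveryMinimalIsCoset a b ⊎ Exceptional a b)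
proposition3p4 F odd a b parameters =
  (λ char3 → [ id , (λ (a≢b , exceptional) → ⊥-elim (a≢b (exceptionalRatios-char3⇒a≡b char3 exceptional))) ]
               everyMinimalIsCoset⊎exceptional) ,
  (λ _ → Sum.map₂ (exceptionalRatios⇒exceptional ∘ proj₂) everyMinimalIsCoset⊎exceptional)
  where open QuadraticQuasigroup F odd parameters
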